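{- Let $S=(s_0,\dots,s_{\ell-1})$ be an aperiodic orientable sequence of order $n$ of length $\ell$. Then $D^{ -1}(S)$ consists of an o-disjoint pair of primitive, mutually complementary aperiodic orientable sequences of order $n+1$, each of length $\ell+1$.
   Context: For a finite binary sequence $S=(s_0,\dots,s_{\ell-1})$ and $0\le i\le \ell-n$, $\mathbf{s}_n(i)=(s_i,\dots,s_{i+n-1})$. The reverse of a tuple $\mathbf{u}=(u_0,\dots,u_{n-1})$ is $\mathbf{u}^R=(u_{n-1},\dots,u_0)$. $S$ is an aperiodic orientable sequence of order $n$ if the $2\ell-2n+2$ tuples $\mathbf{s}_n(i)$ and $\mathbf{s}_n(i)^R$ ($0\le i\le\ell-n$) are all distinct. Two such sequences are disjoint if they share no $n$-tuple, o-disjoint if they share no $n$-tuple in either direction (no $n$-tuple of one equals an $n$-tuple of the other or its reverse). The complement swaps $0$ and $1$ in every position; a sequence is primitive if it is disjoint from its complement. The Lempel map sends $T=(t_0,\dots,t_{\ell})$ to $D(T)=(t_0\oplus t_1,\dots,t_{\ell-1}\oplus t_\ell)$ ($\oplus$ = addition mod 2); $D^{ -1}(S)$ is the set of binary sequences $T$ of length $\ell+1$ with $D(T)=S$. -}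

module Defs where

open import Data.Bool using (Bool; true; false; not; if_then_else_; _xor_)
open import Data.Nat using (ℕ; zero; suc; _∸_; _≤?_)
open import Data.List using (List; []; _∷_; map; take; drop; reverse; upTo; length; _++_)
open import Data.List.Membership.Propositional using (_∈_; _∉_)
open import Data.List.Relation.Unary.Unique.Propositional using (Unique)
open import Data.Product using (_×_)
open import Relation.Nullary.Decidable using (⌊_⌋)

BinSeq : Set
BinSeq = List Bool

tuple : ℕ → BinSeq → ℕ → BinSeq
tuple n s i = take n (drop i s)

windows : ℕ → BinSeq → List BinSeq
windows n s =
  if ⌊ n ≤? length s ⌋
  then map (tuple n s) (upTo (suc (length s ∸ n)))
  else []

AOS : ℕ → BinSeq → Set
AOS n s = Unique (windows n s ++ map reverse (windows n s))

Disjoint : ℕ → BinSeq → BinSeq → Set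
Disjoint n s t = ∀ u → u ∈ windows n s → u ∉ windows n t

ODisjoint : ℕ → BinSeq → BinSeq → Set
ODisjoint n s t = ∀ u → u ∈ windows n s → (u ∉ windows n t) × (reverse u ∉ windows n t)

complement : BinSeq → BinSeq
complement = map not

Primitive : ℕ → BinSeq → Set
Primitive n s = Disjoint n s (complement s)

D : BinSeq → BinSeq
D [] = []
D (a ∷ []) = []
D (a ∷ b ∷ t) = (a xor b) ∷ D (b ∷ t)

open import Relation.Binary.PropositionalEquality using (_≡_)
InDInv : BinSeq → BinSeq → Set
InDInv s t = (length t ≡ suc (length s)) × (D t ≡ s)

module Submission where

-- D sends the (n+1)-windows of T to the n-windows of D T, commutes with reversal and
-- cannot see complementation. So if D T = S is orientable of order n, D is injective on
-- the (n+1)-windows of T and their reverses, which are therefore distinct. If such a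
-- word u were the complement of a window v of T, then D u = D v, so u = v would be a
-- nonempty self-complementary word. The two preimages of S are its prefix xor-sums
-- starting from true and from false, and they are complements of each other.

open import Defs
open import Data.Bool using (Bool; true; false; not; _xor_)
open import Data.Bool.Properties using (xor-assoc; xor-comm; xor-same; not-¬)
open import Data.Nat using (ℕ; zero; suc; _+_; _∸_; _⊓_; _≤_; _≤?_; s≤s⁻¹)
open import Data.Nat.Properties as ℕ using ()
open import Data.List using (List; []; _∷_; _∷ʳ_; map; take; drop; reverse; upTo; length; _++_)
open import Data.List.Properties as List using ()
open import Data.List.Scans.Base using (scanl)
open import Data.List.Membership.Propositional using (_∈_; _∉_)
open import Data.List.Membership.Propositional.Properties using (∈-map⁻; ∈-map⁺; ∈-++⁺ˡ; ∈-++⁺ʳ; ∈-++⁻; ∈-upTo⁻)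
open import Data.List.Relation.Unary.All as All using ()
open import Data.List.Relation.Unary.All.Properties as All using ()
open import Data.List.Relation.Unary.Any using (here; there)
open import Data.List.Relation.Unary.Unique.Propositional using (Unique; _∷_)
import Data.List.Relation.Unary.Unique.Propositional.Properties as Unique
open import Data.Product using (Σ; _×_; _,_)
open import Data.Sum using (_⊎_; inj₁; inj₂)
open import Function using (_∘_)
open import Relation.Nullary using (yes; no; contradiction)
open import Relation.Binary.PropositionalEquality

xor-cancelˡ : ∀ x y → x xor (x xor y) ≡ y
xor-cancelˡ x y = trans (sym (xor-assoc x x y)) (cong (_xor y) (xor-same x))

xor-injectiveʳ : ∀ x {y z} → x xor y ≡ x xor z → y ≡ z
xor-injectiveʳ x {y} {z} e = trans (sym (xor-cancelˡ x y)) (trans (cong (x xor_) e) (xor-cancelˡ x z))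

not-xor-not : ∀ x y → not x xor not y ≡ x xor y
not-xor-not true  true  = refl
not-xor-not true  false = refl
not-xor-not false true  = refl
not-xor-not false false = refl

Unique-map⇒injectiveOn : ∀ {A B : Set} (f : A → B) {xs x y} → Unique (map f xs) →
                         x ∈ xs → y ∈ xs → f x ≡ f y → x ≡ y
Unique-map⇒injectiveOn f {_ ∷ _} (_   ∷ _) (here refl) (here refl) _  = refl
Unique-map⇒injectiveOn f {_ ∷ _} (fx∉ ∷ _) (here refl) (there y∈) fx≡fy =
  contradiction fx≡fy (All.lookup (All.map⁻ fx∉) y∈)
Unique-map⇒injectiveOn f {_ ∷ _} (fy∉ ∷ _) (there x∈) (here refl) fx≡fy =
  contradiction (sym fx≡fy) (All.lookup (All.map⁻ fy∉) x∈)
Unique-map⇒injectiveOn f {_ ∷ _} (_   ∷ u) (there x∈) (there y∈) fx≡fy =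
  Unique-map⇒injectiveOn f u x∈ y∈ fx≡fy

D-complement : ∀ u → D (complement u) ≡ D u
D-complement []          = refl
D-complement (a ∷ [])    = refl
D-complement (a ∷ b ∷ t) = cong₂ _∷_ (not-xor-not a b) (D-complement (b ∷ t))

D-∷ʳ : ∀ xs b c → D (xs ∷ʳ b ∷ʳ c) ≡ D (xs ∷ʳ b) ∷ʳ (b xor c)
D-∷ʳ []           b c = refl
D-∷ʳ (a ∷ [])     b c = refl
D-∷ʳ (a ∷ a′ ∷ r) b c = cong ((a xor a′) ∷_) (D-∷ʳ (a′ ∷ r) b c)

D-reverse : ∀ u → D (reverse u) ≡ reverse (D u)
D-reverse []          = refl
D-reverse (a ∷ [])    = refl
D-reverse (a ∷ b ∷ t) = begin
  D (reverse (a ∷ b ∷ t))              ≡⟨ cong D (trans (List.unfold-reverse a (b ∷ t))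
                                                         (cong (_∷ʳ a) (List.unfold-reverse b t))) ⟩
  D (reverse t ∷ʳ b ∷ʳ a)              ≡⟨ D-∷ʳ (reverse t) b a ⟩
  D (reverse t ∷ʳ b) ∷ʳ (b xor a)      ≡⟨ cong₂ (λ u x → D u ∷ʳ x) (sym (List.unfold-reverse b t)) (xor-comm b a) ⟩
  D (reverse (b ∷ t)) ∷ʳ (a xor b)     ≡⟨ cong (_∷ʳ (a xor b)) (D-reverse (b ∷ t)) ⟩
  reverse (D (b ∷ t)) ∷ʳ (a xor b)     ≡⟨ List.unfold-reverse (a xor b) (D (b ∷ t)) ⟨
  reverse (D (a ∷ b ∷ t))              ∎
  where open ≡-Reasoning

drop-D : ∀ i t → drop i (D t) ≡ D (drop i t)
drop-D zero    t           = refl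
drop-D (suc i) []          = refl
drop-D (suc i) (a ∷ [])    = cong D (sym (List.drop-[] i))
drop-D (suc i) (a ∷ b ∷ t) = drop-D i (b ∷ t)

take-D : ∀ k t → take k (D t) ≡ D (take (suc k) t)
take-D k       []          = List.take-[] k
take-D k       (a ∷ [])    = trans (List.take-[] k) (cong (D ∘ (a ∷_)) (sym (List.take-[] k)))
take-D zero    (a ∷ b ∷ t) = refl
take-D (suc k) (a ∷ b ∷ t) = cong ((a xor b) ∷_) (take-D k (b ∷ t))

length-D : ∀ a t → length (D (a ∷ t)) ≡ length t
length-D a []      = refl
length-D a (b ∷ t) = cong suc (length-D b t)

tuple-D : ∀ k t i → D (tuple (suc k) t i) ≡ tuple k (D t) i
tuple-D k t i = sym (trans (cong (take k) (drop-D i t)) (take-D k (drop i t)))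

tuple-complement : ∀ k s i → complement (tuple k s i) ≡ tuple k (complement s) i
tuple-complement k s i = sym (trans (cong (take k) (List.drop-map i s)) (List.take-map k (drop i s)))

≤-shift : ∀ {k k′ ℓ ℓ′} → k′ + ℓ ≡ k + ℓ′ → k ≤ ℓ → k′ ≤ ℓ′
≤-shift {k} {k′} {ℓ} {ℓ′} shift k≤ℓ = ℕ.+-cancelˡ-≤ k k′ ℓ′ (begin
  k + k′   ≡⟨ ℕ.+-comm k k′ ⟩
  k′ + k   ≤⟨ ℕ.+-monoʳ-≤ k′ k≤ℓ ⟩
  k′ + ℓ   ≡⟨ shift ⟩
  k + ℓ′   ∎)
  where open ℕ.≤-Reasoning

windows-length-shift : ∀ (g : BinSeq → BinSeq) {k k′ s s′} → k′ + length s ≡ k + length s′ →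
                       (∀ i → g (tuple k s i) ≡ tuple k′ s′ i) → map g (windows k s) ≡ windows k′ s′
windows-length-shift g {k} {k′} {s} {s′} shift g-tuple with k ≤? length s | k′ ≤? length s′
... | yes k≤ℓ | yes k′≤ℓ′ = begin
  map g (map (tuple k s) (upTo (suc (length s ∸ k))))  ≡⟨ List.map-∘ (upTo (suc (length s ∸ k))) ⟨
  map (g ∘ tuple k s) (upTo (suc (length s ∸ k)))      ≡⟨ List.map-cong g-tuple (upTo (suc (length s ∸ k))) ⟩
  map (tuple k′ s′) (upTo (suc (length s ∸ k)))        ≡⟨ cong (map (tuple k′ s′) ∘ upTo ∘ suc) same-count ⟩
  map (tuple k′ s′) (upTo (suc (length s′ ∸ k′)))      ∎
  where
  open ≡-Reasoning
  same-count : length s ∸ k ≡ length s′ ∸ k′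
  same-count = begin
    length s ∸ k                    ≡⟨ ℕ.[m+n]∸[m+o]≡n∸o k′ (length s) k ⟨
    (k′ + length s) ∸ (k′ + k)      ≡⟨ cong₂ _∸_ shift (ℕ.+-comm k′ k) ⟩
    (k + length s′) ∸ (k + k′)      ≡⟨ ℕ.[m+n]∸[m+o]≡n∸o k (length s′) k′ ⟩
    length s′ ∸ k′                  ∎
... | yes k≤ℓ | no  k′≰ℓ′ = contradiction (≤-shift shift k≤ℓ) k′≰ℓ′
... | no  k≰ℓ | yes k′≤ℓ′ = contradiction (≤-shift (sym shift) k′≤ℓ′) k≰ℓ
... | no  _   | no  _     = refl

windows-D : ∀ n a t → map D (windows (suc n) (a ∷ t)) ≡ windows n (D (a ∷ t))
windows-D n a t = windows-length-shift D
  (trans (ℕ.+-suc n (length t)) (cong (suc ∘ (n +_)) (sym (length-D a t))))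
  (tuple-D n (a ∷ t))

windows-complement : ∀ k s → map complement (windows k s) ≡ windows k (complement s)
windows-complement k s = windows-length-shift complement
  (cong (k +_) (sym (List.length-map not s)))
  (tuple-complement k s)

∈-windows⇒length : ∀ k s {u} → u ∈ windows k s → length u ≡ k
∈-windows⇒length k s u∈ with k ≤? length s
∈-windows⇒length k s () | no _
... | yes k≤ℓ with ∈-map⁻ (tuple k s) u∈
... | i , i∈ , refl = begin
  length (take k (drop i s))  ≡⟨ List.length-take k (drop i s) ⟩
  k ⊓ length (drop i s)       ≡⟨ cong (k ⊓_) (List.length-drop i s) ⟩
  k ⊓ (length s ∸ i)          ≡⟨ ℕ.m≤n⇒m⊓n≡m k≤ℓ∸i ⟩
  k                           ∎
  where
  open ≡-Reasoning
  k≤ℓ∸i : k ≤ length s ∸ i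
  k≤ℓ∸i = ℕ.m+n≤o⇒m≤o∸n k (subst (_≤ length s) (ℕ.+-comm i k)
            (ℕ.m≤o∸n⇒m+n≤o i k≤ℓ (s≤s⁻¹ (∈-upTo⁻ i∈))))

orientedWindows : ℕ → BinSeq → List BinSeq
orientedWindows k s = windows k s ++ map reverse (windows k s)

∈-orientedWindows⇒length : ∀ k s {u} → u ∈ orientedWindows k s → length u ≡ k
∈-orientedWindows⇒length k s u∈ with ∈-++⁻ (windows k s) u∈
... | inj₁ u∈W = ∈-windows⇒length k s u∈W
... | inj₂ u∈W^R with ∈-map⁻ reverse u∈W^R
...   | v , v∈W , refl = trans (List.length-reverse v) (∈-windows⇒length k s v∈W)

map-D-orientedWindows : ∀ n a t → map D (orientedWindows (suc n) (a ∷ t)) ≡ orientedWindows n (D (a ∷ t))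
map-D-orientedWindows n a t = begin
  map D (W ++ map reverse W)              ≡⟨ List.map-++ D W (map reverse W) ⟩
  map D W ++ map D (map reverse W)        ≡⟨ cong (map D W ++_) D-commutes-with-reverse ⟩
  map D W ++ map reverse (map D W)        ≡⟨ cong (λ V → V ++ map reverse V) (windows-D n a t) ⟩
  orientedWindows n (D (a ∷ t))           ∎
  where
  open ≡-Reasoning
  W = windows (suc n) (a ∷ t)
  D-commutes-with-reverse : map D (map reverse W) ≡ map reverse (map D W)
  D-commutes-with-reverse =
    trans (sym (List.map-∘ W)) (trans (List.map-cong D-reverse W) (List.map-∘ W))

≢-complement-self : ∀ {k} u → length u ≡ suc k → u ≢ complement u
≢-complement-self []      ()
≢-complement-self (a ∷ u) _ a∷u≡ā∷ū = not-¬ refl (List.∷-injectiveˡ a∷u≡ā∷ū)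

module Lift {n a t} (aos : AOS n (D (a ∷ t))) where

  Unique-map-D : Unique (map D (orientedWindows (suc n) (a ∷ t)))
  Unique-map-D = subst Unique (sym (map-D-orientedWindows n a t)) aos

  AOS-lift : AOS (suc n) (a ∷ t)
  AOS-lift = Unique.map⁻ Unique-map-D

  ≢-complement : ∀ {u v} → u ∈ orientedWindows (suc n) (a ∷ t) → v ∈ orientedWindows (suc n) (a ∷ t) →
                 u ≢ complement v
  ≢-complement {u} {v} u∈ v∈ u≡v̄ = ≢-complement-self v (∈-orientedWindows⇒length (suc n) (a ∷ t) v∈)
    (trans (sym u≡v) u≡v̄)
    where
    u≡v : u ≡ v
    u≡v = Unique-map⇒injectiveOn D Unique-map-D u∈ v∈ (trans (cong D u≡v̄) (D-complement v))

  ∉-windows-complement : ∀ {u} → u ∈ orientedWindows (suc n) (a ∷ t) →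
                         u ∉ windows (suc n) (complement (a ∷ t))
  ∉-windows-complement u∈ u∈W̄
    with ∈-map⁻ complement (subst (_ ∈_) (sym (windows-complement (suc n) (a ∷ t))) u∈W̄)
  ... | v , v∈W , u≡v̄ = ≢-complement u∈ (∈-++⁺ˡ v∈W) u≡v̄

  primitive-lift : Primitive (suc n) (a ∷ t)
  primitive-lift u u∈W = ∉-windows-complement (∈-++⁺ˡ u∈W)

  oDisjoint-lift : ODisjoint (suc n) (a ∷ t) (complement (a ∷ t))
  oDisjoint-lift u u∈W =
    primitive-lift u u∈W , ∉-windows-complement (∈-++⁺ʳ (windows (suc n) (a ∷ t)) (∈-map⁺ reverse u∈W))

D-scanl-xor : ∀ a S → D (scanl _xor_ a S) ≡ S
D-scanl-xor a []      = refl
D-scanl-xor a (s ∷ S) = cong₂ _∷_ (xor-cancelˡ a s) (D-scanl-xor (a xor s) S)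

length-scanl : ∀ {A B : Set} (f : A → B → A) a S → length (scanl f a S) ≡ suc (length S)
length-scanl f a []      = refl
length-scanl f a (s ∷ S) = cong suc (length-scanl f (f a s) S)

D-∷-injective : ∀ a {t u} → D (a ∷ t) ≡ D (a ∷ u) → t ≡ u
D-∷-injective a {[]}    {[]}    _ = refl
D-∷-injective a {b ∷ t} {c ∷ u} e with refl ← xor-injectiveʳ a (List.∷-injectiveˡ e) =
  cong (b ∷_) (D-∷-injective b (List.∷-injectiveʳ e))

theorem6 : (n : ℕ) (S : BinSeq) → AOS n S →
    Σ BinSeq λ T₁ → Σ BinSeq λ T₂ →
      InDInv S T₁ × InDInv S T₂ × T₁ ≢ T₂
      × (∀ T → InDInv S T → (T ≡ T₁) ⊎ (T ≡ T₂))
      × T₂ ≡ complement T₁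
      × AOS (suc n) T₁ × AOS (suc n) T₂
      × length T₁ ≡ suc (length S) × length T₂ ≡ suc (length S)
      × Primitive (suc n) T₁ × Primitive (suc n) T₂
      × ODisjoint (suc n) T₁ T₂
theorem6 n S aos =
  T , complement T , (length-T , D-T) , (length-T̄ , D-T̄) , (λ ()) , preimages , refl ,
  L.AOS-lift , L̄.AOS-lift , length-T , length-T̄ , L.primitive-lift , L̄.primitive-lift , L.oDisjoint-lift
  where
  -- scanl _xor_ true S reduces to true ∷ t; naming t fixes the implicit arguments of Lift.
  t = drop 1 (scanl _xor_ true S)
  T = true ∷ t
  D-T : D T ≡ S
  D-T = D-scanl-xor true S
  D-T̄ : D (complement T) ≡ S
  D-T̄ = trans (D-complement T) D-T
  length-T : length T ≡ suc (length S)
  length-T = length-scanl _xor_ true S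
  length-T̄ : length (complement T) ≡ suc (length S)
  length-T̄ = trans (List.length-map not T) length-T
  module L = Lift {n} {true} {t} (subst (AOS n) (sym D-T) aos)
  module L̄ = Lift {n} {false} {complement t} (subst (AOS n) (sym D-T̄) aos)
  preimages : ∀ U → InDInv S U → (U ≡ T) ⊎ (U ≡ complement T)
  preimages []          (() , _)
  preimages (true  ∷ u) (_ , D-U) = inj₁ (cong (true ∷_)  (D-∷-injective true  (trans D-U (sym D-T))))
  preimages (false ∷ u) (_ , D-U) = inj₂ (cong (false ∷_) (D-∷-injective false (trans D-U (sym D-T̄))))
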